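{- Let $m\ge 0$ be an integer and let $G$ be a graph on $n$ vertices with $n\ge 3m^2+4m$. Let $c$ be an edge coloring of $G$ with total color degree $\hat d(G)\ge 2mn$. Then $G$ contains a rainbow matching (with respect to $c$) of size $m$.
   Context: All graphs are finite and simple. An edge coloring of $G$ is any assignment $c:E(G)\to[r]$ of colors to edges (not necessarily proper). For a vertex $v$, the color degree $\hat d(v)$ is the number of distinct colors that $c$ assigns to edges incident to $v$. The total color degree of $G$ is $\hat d(G)=\sum_{v\in V(G)}\hat d(v)$. A matching of size $k$ is a set of $k$ pairwise vertex-disjoint edges; it is rainbow if its edges receive pairwise distinct colors. -}

module Defs where

open import Data.Nat using (ℕ; _≟_)
open import Data.Fin using (Fin)
open import Data.Bool using (Bool; T)
open import Data.List using (List; length; map; filterᵇ; allFin; deduplicate)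
open import Data.Nat.ListAction using (sum)
open import Data.Vec using (Vec; lookup)
open import Data.Product using (_×_; proj₁; proj₂)
open import Relation.Binary.PropositionalEquality using (_≡_; _≢_)
open import Relation.Nullary using (¬_)

record Graph (n : ℕ) : Set where
  field
    adj   : Fin n → Fin n → Bool
    sym   : ∀ u v → adj u v ≡ adj v u
    irref : ∀ v → ¬ T (adj v v)
open Graph public

-- An edge coloring: colors are natural numbers; the color of edge uv is
-- col u v, required to be symmetric (so it is a function of the unordered
-- edge). Values at non-edges are irrelevant.
record EdgeColoring {n : ℕ} (G : Graph n) : Set where
  field
    col    : Fin n → Fin n → ℕ
    colSym : ∀ u v → col u v ≡ col v u
open EdgeColoring public

nbrs : ∀ {n} (G : Graph n) → Fin n → List (Fin n)
nbrs {n} G v = filterᵇ (adj G v) (allFin n)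

colorDegree : ∀ {n} {G : Graph n} → EdgeColoring G → Fin n → ℕ
colorDegree {n} {G} c v = length (deduplicate _≟_ (map (col c v) (nbrs G v)))

totalColorDegree : ∀ {n} {G : Graph n} → EdgeColoring G → ℕ
totalColorDegree {n} {G} c = sum (map (colorDegree c) (allFin n))

record RainbowMatching {n : ℕ} (G : Graph n) (c : EdgeColoring G) (m : ℕ) : Set where
  field
    edges    : Vec (Fin n × Fin n) m
    isEdge   : ∀ i → T (adj G (proj₁ (lookup edges i)) (proj₂ (lookup edges i)))
    disjoint : ∀ i j → i ≢ j →
               proj₁ (lookup edges i) ≢ proj₁ (lookup edges j) ×
               proj₁ (lookup edges i) ≢ proj₂ (lookup edges j) ×
               proj₂ (lookup edges i) ≢ proj₁ (lookup edges j) ×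
               proj₂ (lookup edges i) ≢ proj₂ (lookup edges j)
    rainbow  : ∀ i j → i ≢ j →
               col c (proj₁ (lookup edges i)) (proj₂ (lookup edges i)) ≢
               col c (proj₁ (lookup edges j)) (proj₂ (lookup edges j))

module Submission where

-- Let m = m₀ + 1 and call a vertex poor if its color degree is at most 4m − 3, rich
-- otherwise; say there are r rich vertices.  Rich vertices are matched greedily at the end:
-- with j edges present, a rich vertex only has to avoid the colors of those edges and of its
-- edges into their 2j ends and into the rich vertices still waiting, fewer than 3m − 1 colors.
-- So it suffices to grow a rainbow matching M of size m − r inside the poor vertices, either
-- by an edge between two uncovered ones or by trading an edge ab of M for ua and u′b.  When
-- neither is possible, an uncovered poor vertex sees inside the poor set only the k colors of
-- M and the free colors towards the ends of the edges of M, and at most two uncovered vertices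
-- see two different free colors at the same edge; covered poor vertices see at most 4m − 3
-- colors.  Summing, the total color degree is below 2mn once n ≥ 3m² + 4m.

open import Data.Bool using (Bool; true; false; T; not)
open import Data.Empty using (⊥; ⊥-elim)
open import Data.Fin using (Fin; zero; suc) renaming (_≟_ to _≟ᶠ_)
open import Data.Fin.Properties using (any?)
open import Data.List
  using (List; []; _∷_; [_]; _++_; length; map; filterᵇ; concatMap; deduplicate; allFin; take; tabulate)
open import Data.List.Properties using (length-++; length-map; length-tabulate; length-take; length-removeAt′)
open import Data.List.Membership.Propositional using (_∈_; _∉_; find; lose)
open import Data.List.Membership.Propositional.Properties
  using (∈-map⁺; ∈-map⁻; ∈-filter⁺; ∈-filter⁻; ∈-allFin; ∈-tabulate⁺; ∈-++⁺ˡ; ∈-++⁺ʳ;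
         ∈-deduplicate⁺; ∈-deduplicate⁻; ∈-concatMap⁺; ∈-concatMap⁻)
import Data.List.Membership.DecPropositional as DecMembership
open import Data.List.Relation.Binary.Subset.Propositional using (_⊆_)
open import Data.List.Relation.Unary.All as All using (All; []; _∷_; all?)
import Data.List.Relation.Unary.All.Properties as Allₚ
open import Data.List.Relation.Unary.Any using (Any; here; there; index; _─_)
import Data.List.Relation.Unary.Any.Properties as Anyₚ
open import Data.List.Relation.Unary.AllPairs using ([]; _∷_)
open import Data.List.Relation.Unary.Unique.Propositional using (Unique)
import Data.List.Relation.Unary.Unique.Propositional.Properties as Uniqueₚ
open import Data.List.Relation.Unary.Unique.DecPropositional.Properties using (deduplicate-!)
open import Data.Nat using (ℕ; zero; suc; _+_; _*_; _∸_; _⊓_; _≤_; _<_; _≥_; z≤n; s≤s; _≤?_)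
  renaming (_≟_ to _≟ℕ_)
open import Data.Nat.ListAction using (sum)
open import Data.Nat.Properties
open import Data.Nat.Tactic.RingSolver using (solve-∀)
open import Data.Product using (∃; _×_; _,_; proj₁; proj₂)
open import Data.Sum using (_⊎_; inj₁; inj₂)
open import Data.Unit using (tt)
open import Data.Vec using (lookup) renaming (tabulate to tabulateᵛ)
open import Data.Vec.Properties using (lookup∘tabulate)
open import Function using (_∘_)
open import Relation.Binary.Definitions using (DecidableEquality)
open import Relation.Binary.PropositionalEquality
  using (_≡_; _≢_; refl; sym; trans; cong; cong₂; subst; subst₂; ≢-sym; module ≡-Reasoning)
open import Relation.Nullary using (¬_; Dec; yes; no; contradiction)
open import Relation.Nullary.Decidable
  using (T?; _×-dec_; ¬?; isYes; toWitness; fromWitness; toWitnessFalse)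

open import Defs hiding (sym)

map-⊆ : ∀ {A B : Set} {f : A → B} {xs : List A} {ys : List B} →
        (∀ {x} → x ∈ xs → f x ∈ ys) → map f xs ⊆ ys
map-⊆ {f = f} f[xs]⊆ys z∈map with ∈-map⁻ f z∈map
... | _ , x∈xs , refl = f[xs]⊆ys x∈xs

module _ {A : Set} where

  ∈-─ : ∀ {x z : A} {ys} (x∈ys : x ∈ ys) → z ∈ ys → z ≢ x → z ∈ (ys ─ x∈ys)
  ∈-─ (here refl) (here refl)  z≢x = contradiction refl z≢x
  ∈-─ (here refl) (there z∈ys) _   = z∈ys
  ∈-─ (there _)   (here refl)  _   = here refl
  ∈-─ (there x∈ys) (there z∈ys) z≢x = there (∈-─ x∈ys z∈ys z≢x)

  Unique⇒length≤ : ∀ {xs ys : List A} → Unique xs → xs ⊆ ys → length xs ≤ length ys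
  Unique⇒length≤ [] _ = z≤n
  Unique⇒length≤ {x ∷ xs} {ys} (x≢xs ∷ xs!) xs⊆ys = begin
    suc (length xs)          ≤⟨ s≤s (Unique⇒length≤ xs! xs⊆ys─x) ⟩
    suc (length (ys ─ x∈ys)) ≡⟨ sym (length-removeAt′ ys (index x∈ys)) ⟩
    length ys                ∎
    where
    open ≤-Reasoning
    x∈ys : x ∈ ys
    x∈ys = xs⊆ys (here refl)
    xs⊆ys─x : xs ⊆ (ys ─ x∈ys)
    xs⊆ys─x z∈xs = ∈-─ x∈ys (xs⊆ys (there z∈xs)) (≢-sym (All.lookup x≢xs z∈xs))

  Unique-no-three⇒length≤2 : ∀ {xs : List A} → Unique xs →
    (∀ {u v w} → u ∈ xs → v ∈ xs → w ∈ xs → u ≢ v → u ≢ w → v ≢ w → ⊥) → length xs ≤ 2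
  Unique-no-three⇒length≤2 {[]}                 _ _ = z≤n
  Unique-no-three⇒length≤2 {_ ∷ []}             _ _ = s≤s z≤n
  Unique-no-three⇒length≤2 {_ ∷ _ ∷ []}         _ _ = s≤s (s≤s z≤n)
  Unique-no-three⇒length≤2 {_ ∷ _ ∷ _ ∷ _} ((u≢v ∷ u≢w ∷ _) ∷ (v≢w ∷ _) ∷ _) no-three =
    ⊥-elim (no-three (here refl) (there (here refl)) (there (there (here refl))) u≢v u≢w v≢w)

module _ {A : Set} (_≟_ : DecidableEquality A) where

  open DecMembership _≟_ using (_∈?_)

  length-deduplicate≤ : ∀ {xs ys : List A} → xs ⊆ ys → length (deduplicate _≟_ xs) ≤ length ys
  length-deduplicate≤ {xs} xs⊆ys = Unique⇒length≤ (deduplicate-! _≟_ xs) (xs⊆ys ∘ ∈-deduplicate⁻ _≟_ xs)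

  length-deduplicate>⇒∉ : ∀ {xs ys : List A} →
    length ys < length (deduplicate _≟_ xs) → Any (_∉ ys) xs
  length-deduplicate>⇒∉ {xs} {ys} ys<xs with all? (_∈? ys) xs
  ... | yes xs⊆ys = contradiction (length-deduplicate≤ (All.lookup xs⊆ys)) (<⇒≱ ys<xs)
  ... | no  xs⊈ys = Allₚ.¬All⇒Any¬ (_∈? ys) xs xs⊈ys

¬T⇒T-not : ∀ {b} → ¬ T b → T (not b)
¬T⇒T-not {true}  ¬t = ¬t tt
¬T⇒T-not {false} _  = tt

T-not⇒¬T : ∀ {b} → T (not b) → ¬ T b
T-not⇒¬T {true} ()

union₂ : Bool → ℕ → Bool → ℕ → List ℕ
union₂ false x false y = []
union₂ false x true  y = [ y ]
union₂ true  x false y = [ x ]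
union₂ true  x true  y with x ≟ℕ y
... | yes _ = [ x ]
... | no  _ = x ∷ y ∷ []

∈-union₂ˡ : ∀ {p q x y} → T p → x ∈ union₂ p x q y
∈-union₂ˡ {true} {false}       _ = here refl
∈-union₂ˡ {true} {true} {x} {y} _ with x ≟ℕ y
... | yes _ = here refl
... | no  _ = here refl

∈-union₂ʳ : ∀ {p q x y} → T q → y ∈ union₂ p x q y
∈-union₂ʳ {false} {true}             _ = here refl
∈-union₂ʳ {true}  {true} {x} {y} _ with x ≟ℕ y
... | yes x≡y = here (sym x≡y)
... | no  _   = there (here refl)

bothDistinct : Bool → ℕ → Bool → ℕ → Bool
bothDistinct true x true y with x ≟ℕ y
... | yes _ = false
... | no  _ = true
bothDistinct _    _ _    _ = false

bothDistinct⁻ : ∀ {p q x y} → T (bothDistinct p x q y) → T p × T q × x ≢ y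
bothDistinct⁻ {true} {true} {x} {y} t with x ≟ℕ y
... | no x≢y = tt , tt , x≢y
bothDistinct⁻ {true} {false} ()
bothDistinct⁻ {false} ()

𝟙 : Bool → ℕ
𝟙 true  = 1
𝟙 false = 0

length-union₂ : ∀ p x q y → length (union₂ p x q y) ≤ 1 + 𝟙 (bothDistinct p x q y)
length-union₂ false x false y = z≤n
length-union₂ false x true  y = s≤s z≤n
length-union₂ true  x false y = s≤s z≤n
length-union₂ true  x true  y with x ≟ℕ y
... | yes _ = s≤s z≤n
... | no  _ = ≤-refl

-- Finite sums

∑ : ∀ {A : Set} → List A → (A → ℕ) → ℕ
∑ xs f = sum (map f xs)

syntax ∑ xs (λ x → e) = ∑[ x ∈ xs ] e

module _ {A : Set} where

  ∑-mono-≤ : ∀ {f g : A → ℕ} (xs : List A) → (∀ {x} → x ∈ xs → f x ≤ g x) → ∑ xs f ≤ ∑ xs g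
  ∑-mono-≤ []       _   = z≤n
  ∑-mono-≤ (x ∷ xs) f≤g = +-mono-≤ (f≤g (here refl)) (∑-mono-≤ xs (f≤g ∘ there))

  ∑-distrib-+ : ∀ (f g : A → ℕ) xs → ∑[ x ∈ xs ] (f x + g x) ≡ ∑ xs f + ∑ xs g
  ∑-distrib-+ f g []       = refl
  ∑-distrib-+ f g (x ∷ xs) = trans (cong (f x + g x +_) (∑-distrib-+ f g xs)) (+-interchange (f x) _ _ _ )
    where
    +-interchange : ∀ a b c d → a + b + (c + d) ≡ a + c + (b + d)
    +-interchange = solve-∀

  ∑-const : ∀ k (xs : List A) → ∑[ _ ∈ xs ] k ≡ k * length xs
  ∑-const k []       = sym (*-zeroʳ k)
  ∑-const k (x ∷ xs) = trans (cong (k +_) (∑-const k xs)) (sym (*-suc k (length xs)))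

  ∑-𝟙 : ∀ (p : A → Bool) xs → ∑[ x ∈ xs ] 𝟙 (p x) ≡ length (filterᵇ p xs)
  ∑-𝟙 p []       = refl
  ∑-𝟙 p (x ∷ xs) with p x
  ... | true  = cong suc (∑-𝟙 p xs)
  ... | false = ∑-𝟙 p xs

  ∑-partition : ∀ (p : A → Bool) xs (f : A → ℕ) →
    ∑ xs f ≡ ∑ (filterᵇ p xs) f + ∑ (filterᵇ (not ∘ p) xs) f
  ∑-partition p []       f = refl
  ∑-partition p (x ∷ xs) f with p x
  ... | true  = trans (cong (f x +_) (∑-partition p xs f)) (sym (+-assoc (f x) _ _))
  ... | false = trans (cong (f x +_) (∑-partition p xs f)) (+-left-comm (f x) (∑ (filterᵇ p xs) f) _)
    where
    +-left-comm : ∀ a b c → a + (b + c) ≡ b + (a + c)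
    +-left-comm = solve-∀

  ∑-1 : ∀ (xs : List A) → ∑[ _ ∈ xs ] 1 ≡ length xs
  ∑-1 xs = trans (∑-const 1 xs) (*-identityˡ (length xs))

  length-partition : ∀ (p : A → Bool) xs → length xs ≡ length (filterᵇ p xs) + length (filterᵇ (not ∘ p) xs)
  length-partition p xs = begin
    length xs                               ≡⟨ sym (∑-1 xs) ⟩
    ∑[ _ ∈ xs ] 1                           ≡⟨ ∑-partition p xs _ ⟩
    ∑[ _ ∈ filterᵇ p xs ] 1 + ∑[ _ ∈ filterᵇ (not ∘ p) xs ] 1
      ≡⟨ cong₂ _+_ (∑-1 (filterᵇ p xs)) (∑-1 (filterᵇ (not ∘ p) xs)) ⟩
    length (filterᵇ p xs) + length (filterᵇ (not ∘ p) xs) ∎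
    where open ≡-Reasoning

  length-concatMap : ∀ {B : Set} (f : A → List B) xs → length (concatMap f xs) ≡ ∑[ x ∈ xs ] length (f x)
  length-concatMap f []       = refl
  length-concatMap f (x ∷ xs) = trans (length-++ (f x)) (cong (length (f x) +_) (length-concatMap f xs))

∑-comm : ∀ {A B : Set} (xs : List A) (ys : List B) (f : A → B → ℕ) →
  ∑[ x ∈ xs ] ∑[ y ∈ ys ] f x y ≡ ∑[ y ∈ ys ] ∑[ x ∈ xs ] f x y
∑-comm []       ys f = sym (∑-const 0 ys)
∑-comm (x ∷ xs) ys f = trans (cong (∑ ys (f x) +_) (∑-comm xs ys f))
                             (sym (∑-distrib-+ (f x) (λ y → ∑[ x′ ∈ xs ] f x′ y) ys))

-- Color degrees

module _ {n : ℕ} {G : Graph n} (c : EdgeColoring G) where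

  colorDegreeInto : (Fin n → Bool) → Fin n → ℕ
  colorDegreeInto S v = length (deduplicate _≟ℕ_ (map (col c v) (filterᵇ S (nbrs G v))))

  adj⇒∈nbrs : ∀ {v w} → T (adj G v w) → w ∈ nbrs G v
  adj⇒∈nbrs {v} {w} = ∈-filter⁺ (T? ∘ adj G v) (∈-allFin w)

  ∈nbrs⇒adj : ∀ {v w} → w ∈ nbrs G v → T (adj G v w)
  ∈nbrs⇒adj {v} = proj₂ ∘ ∈-filter⁻ (T? ∘ adj G v) {xs = allFin n}

  colorDegree≤length : ∀ {v ys} → (∀ {w} → T (adj G v w) → col c v w ∈ ys) → colorDegree c v ≤ length ys
  colorDegree≤length incident⊆ys = length-deduplicate≤ _≟ℕ_ (map-⊆ (incident⊆ys ∘ ∈nbrs⇒adj))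

  colorDegreeInto≤length : ∀ S {v ys} → (∀ {w} → T (adj G v w) → T (S w) → col c v w ∈ ys) →
    colorDegreeInto S v ≤ length ys
  colorDegreeInto≤length S {v} incident⊆ys = length-deduplicate≤ _≟ℕ_ (map-⊆ λ w∈ →
    let w∈nbrs , Sw = ∈-filter⁻ (T? ∘ S) {xs = nbrs G v} w∈ in incident⊆ys (∈nbrs⇒adj w∈nbrs) Sw)

  fresh-color : ∀ {v ys} → length ys < colorDegree c v → ∃ λ w → T (adj G v w) × col c v w ∉ ys
  fresh-color {v} ys<d with find (Anyₚ.map⁻ (length-deduplicate>⇒∉ _≟ℕ_ ys<d))
  ... | w , w∈nbrs , vw∉ys = w , ∈nbrs⇒adj w∈nbrs , vw∉ys

  colorDegreeInto≤colorDegree : ∀ S v → colorDegreeInto S v ≤ colorDegree c v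
  colorDegreeInto≤colorDegree S v =
    colorDegreeInto≤length S λ vw _ → ∈-deduplicate⁺ _≟ℕ_ (∈-map⁺ (col c v) (adj⇒∈nbrs vw))

  colorDegree≤n : ∀ v → colorDegree c v ≤ n
  colorDegree≤n v = begin
    colorDegree c v                  ≤⟨ colorDegree≤length (λ {w} _ → ∈-map⁺ (col c v) (∈-allFin w)) ⟩
    length (map (col c v) (allFin n)) ≡⟨ length-map (col c v) (allFin n) ⟩
    length (allFin n)                 ≡⟨ length-tabulate _ ⟩
    n                                 ∎
    where open ≤-Reasoning

  colorDegree≤colorDegreeInto+ : ∀ S v →
    colorDegree c v ≤ colorDegreeInto S v + length (filterᵇ (not ∘ S) (allFin n))
  colorDegree≤colorDegreeInto+ S v = begin
    colorDegree c v                    ≤⟨ colorDegree≤length incident⊆ ⟩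
    length (intoS ++ map (col c v) outS) ≡⟨ length-++ intoS ⟩
    colorDegreeInto S v + length (map (col c v) outS)
      ≡⟨ cong (colorDegreeInto S v +_) (length-map (col c v) outS) ⟩
    colorDegreeInto S v + length outS  ∎
    where
    open ≤-Reasoning
    intoS outS : List _
    intoS = deduplicate _≟ℕ_ (map (col c v) (filterᵇ S (nbrs G v)))
    outS  = filterᵇ (not ∘ S) (allFin n)
    incident⊆ : ∀ {w} → T (adj G v w) → col c v w ∈ intoS ++ map (col c v) outS
    incident⊆ {w} vw with T? (S w)
    ... | yes Sw = ∈-++⁺ˡ (∈-deduplicate⁺ _≟ℕ_ (∈-map⁺ (col c v) (∈-filter⁺ (T? ∘ S) (adj⇒∈nbrs vw) Sw)))
    ... | no ¬Sw = ∈-++⁺ʳ intoS (∈-map⁺ (col c v) (∈-filter⁺ (T? ∘ (not ∘ S)) (∈-allFin w)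
                     (¬T⇒T-not ¬Sw)))

-- Rainbow matchings inside a vertex set

module _ {n : ℕ} where

  _∉ₑ_ : Fin n → Fin n × Fin n → Set
  x ∉ₑ e = x ≢ proj₁ e × x ≢ proj₂ e

  Disjoint : Fin n × Fin n → Fin n × Fin n → Set
  Disjoint e f = proj₁ e ∉ₑ f × proj₂ e ∉ₑ f

  Disjoint-sym : ∀ {e f} → Disjoint e f → Disjoint f e
  Disjoint-sym ((e₁≢f₁ , e₁≢f₂) , (e₂≢f₁ , e₂≢f₂)) =
    (≢-sym e₁≢f₁ , ≢-sym e₂≢f₁) , (≢-sym e₁≢f₂ , ≢-sym e₂≢f₂)

  ends : Fin n × Fin n → List (Fin n)
  ends e = proj₁ e ∷ proj₂ e ∷ []

module _ {n : ℕ} {G : Graph n} (c : EdgeColoring G) where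

  color : Fin n × Fin n → ℕ
  color e = col c (proj₁ e) (proj₂ e)

  record RainbowMatchingIn (S : Fin n → Bool) (k : ℕ) : Set where
    field
      edge     : Fin k → Fin n × Fin n
      isEdge   : ∀ i → T (adj G (proj₁ (edge i)) (proj₂ (edge i)))
      disjoint : ∀ i j → i ≢ j → Disjoint (edge i) (edge j)
      rainbow  : ∀ i j → i ≢ j → color (edge i) ≢ color (edge j)
      inside   : ∀ i → T (S (proj₁ (edge i))) × T (S (proj₂ (edge i)))

    vertices : List (Fin n)
    vertices = concatMap ends (tabulate edge)

    colors : List ℕ
    colors = map color (tabulate edge)

    ∈-vertices⁻ : ∀ {x} → x ∈ vertices → ∃ λ i → x ≡ proj₁ (edge i) ⊎ x ≡ proj₂ (edge i)
    ∈-vertices⁻ x∈ with Anyₚ.tabulate⁻ (∈-concatMap⁻ ends {xs = tabulate edge} x∈)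
    ... | i , here x≡a         = i , inj₁ x≡a
    ... | i , there (here x≡b) = i , inj₂ x≡b

    ∉-vertices : ∀ {x} → x ∉ vertices → ∀ i → x ∉ₑ edge i
    ∉-vertices x∉ i = (λ { refl → x∉ (∈-concatMap⁺ ends (Anyₚ.tabulate⁺ i (here refl))) })
                    , (λ { refl → x∉ (∈-concatMap⁺ ends (Anyₚ.tabulate⁺ i (there (here refl)))) })

    fresh-Disjoint : ∀ {u w} → u ∉ vertices → w ∉ vertices → ∀ i → Disjoint (u , w) (edge i)
    fresh-Disjoint u∉ w∉ i = ∉-vertices u∉ i , ∉-vertices w∉ i

    ∉-colors : ∀ {z} → z ∉ colors → ∀ i → z ≢ color (edge i)
    ∉-colors z∉ i refl = z∉ (∈-map⁺ color (∈-tabulate⁺ i))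

    outside⇒∉vertices : ∀ {x} → ¬ T (S x) → x ∉ vertices
    outside⇒∉vertices ¬Sx x∈ with ∈-vertices⁻ x∈
    ... | i , inj₁ refl = ¬Sx (proj₁ (inside i))
    ... | i , inj₂ refl = ¬Sx (proj₂ (inside i))

    length-vertices : length vertices ≡ 2 * k
    length-vertices = begin
      length vertices            ≡⟨ length-concatMap ends (tabulate edge) ⟩
      ∑[ _ ∈ tabulate edge ] 2   ≡⟨ ∑-const 2 (tabulate edge) ⟩
      2 * length (tabulate edge) ≡⟨ cong (2 *_) (length-tabulate edge) ⟩
      2 * k                      ∎
      where open ≡-Reasoning

    length-colors : length colors ≡ k
    length-colors = trans (length-map color (tabulate edge)) (length-tabulate edge)

  open RainbowMatchingIn public

  empty : ∀ {S} → RainbowMatchingIn S 0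
  empty = record { edge = λ () ; isEdge = λ () ; disjoint = λ () ; rainbow = λ () ; inside = λ () }

  weaken : ∀ {S k} → RainbowMatchingIn S k → RainbowMatchingIn (λ _ → true) k
  weaken M = record { RainbowMatchingIn M ; inside = λ _ → tt , tt }

  extend : ∀ {S k} (M : RainbowMatchingIn S k) (e : Fin n × Fin n) →
    T (adj G (proj₁ e) (proj₂ e)) → T (S (proj₁ e)) × T (S (proj₂ e)) →
    (∀ j → Disjoint e (edge M j)) → (∀ j → color e ≢ color (edge M j)) → RainbowMatchingIn S (suc k)
  extend {S} {k} M e isEdge-e inside-e disjoint-e rainbow-e = record
    { edge = edge′ ; isEdge = isEdge′ ; disjoint = disjoint′ ; rainbow = rainbow′ ; inside = inside′ }
    where
    edge′ : Fin (suc k) → Fin n × Fin n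
    edge′ zero    = e
    edge′ (suc i) = edge M i
    isEdge′ : ∀ i → T (adj G (proj₁ (edge′ i)) (proj₂ (edge′ i)))
    isEdge′ zero    = isEdge-e
    isEdge′ (suc i) = isEdge M i
    disjoint′ : ∀ i j → i ≢ j → Disjoint (edge′ i) (edge′ j)
    disjoint′ zero    zero    0≢0 = contradiction refl 0≢0
    disjoint′ zero    (suc j) _   = disjoint-e j
    disjoint′ (suc i) zero    _   = Disjoint-sym (disjoint-e i)
    disjoint′ (suc i) (suc j) i≢j = disjoint M i j (i≢j ∘ cong suc)
    rainbow′ : ∀ i j → i ≢ j → color (edge′ i) ≢ color (edge′ j)
    rainbow′ zero    zero    0≢0 = contradiction refl 0≢0
    rainbow′ zero    (suc j) _   = rainbow-e j
    rainbow′ (suc i) zero    _   = ≢-sym (rainbow-e i)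
    rainbow′ (suc i) (suc j) i≢j = rainbow M i j (i≢j ∘ cong suc)
    inside′ : ∀ i → T (S (proj₁ (edge′ i))) × T (S (proj₂ (edge′ i)))
    inside′ zero    = inside-e
    inside′ (suc i) = inside M i

  replace : ∀ {S k} (M : RainbowMatchingIn S k) (i : Fin k) (e : Fin n × Fin n) →
    T (adj G (proj₁ e) (proj₂ e)) → T (S (proj₁ e)) × T (S (proj₂ e)) →
    (∀ j → j ≢ i → Disjoint e (edge M j)) → (∀ j → j ≢ i → color e ≢ color (edge M j)) →
    RainbowMatchingIn S k
  replace {S} {k} M i e isEdge-e inside-e disjoint-e rainbow-e = record
    { edge = λ j → edge′ j (j ≟ᶠ i) ; isEdge = λ j → isEdge′ j (j ≟ᶠ i)
    ; disjoint = λ j j′ j≢j′ → disjoint′ j j′ j≢j′ (j ≟ᶠ i) (j′ ≟ᶠ i)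
    ; rainbow = λ j j′ j≢j′ → rainbow′ j j′ j≢j′ (j ≟ᶠ i) (j′ ≟ᶠ i)
    ; inside = λ j → inside′ j (j ≟ᶠ i) }
    where
    edge′ : ∀ j → Dec (j ≡ i) → Fin n × Fin n
    edge′ j (yes _) = e
    edge′ j (no  _) = edge M j
    isEdge′ : ∀ j d → T (adj G (proj₁ (edge′ j d)) (proj₂ (edge′ j d)))
    isEdge′ j (yes _) = isEdge-e
    isEdge′ j (no  _) = isEdge M j
    disjoint′ : ∀ j j′ → j ≢ j′ → ∀ d d′ → Disjoint (edge′ j d) (edge′ j′ d′)
    disjoint′ j j′ j≢j′ (yes j≡i) (yes j′≡i) = contradiction (trans j≡i (sym j′≡i)) j≢j′
    disjoint′ j j′ _    (yes _)   (no j′≢i)  = disjoint-e j′ j′≢i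
    disjoint′ j j′ _    (no j≢i)  (yes _)    = Disjoint-sym (disjoint-e j j≢i)
    disjoint′ j j′ j≢j′ (no _)    (no _)     = disjoint M j j′ j≢j′
    rainbow′ : ∀ j j′ → j ≢ j′ → ∀ d d′ → color (edge′ j d) ≢ color (edge′ j′ d′)
    rainbow′ j j′ j≢j′ (yes j≡i) (yes j′≡i) = contradiction (trans j≡i (sym j′≡i)) j≢j′
    rainbow′ j j′ _    (yes _)   (no j′≢i)  = rainbow-e j′ j′≢i
    rainbow′ j j′ _    (no j≢i)  (yes _)    = ≢-sym (rainbow-e j j≢i)
    rainbow′ j j′ j≢j′ (no _)    (no _)     = rainbow M j j′ j≢j′
    inside′ : ∀ j d → T (S (proj₁ (edge′ j d))) × T (S (proj₂ (edge′ j d)))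
    inside′ j (yes _) = inside-e
    inside′ j (no  _) = inside M j

  toRainbowMatching : ∀ {S k} → RainbowMatchingIn S k → RainbowMatching G c k
  toRainbowMatching M = record
    { edges    = tabulateᵛ (edge M)
    ; isEdge   = λ i → subst (λ e → T (adj G (proj₁ e) (proj₂ e))) (sym (at i)) (isEdge M i)
    ; disjoint = λ i j i≢j → flatten (subst₂ Disjoint (sym (at i)) (sym (at j)) (disjoint M i j i≢j))
    ; rainbow  = λ i j i≢j → subst₂ (λ e f → color e ≢ color f) (sym (at i)) (sym (at j)) (rainbow M i j i≢j)
    }
    where
    at : ∀ i → lookup (tabulateᵛ (edge M)) i ≡ edge M i
    at = lookup∘tabulate (edge M)
    flatten : ∀ {e f : Fin n × Fin n} → Disjoint e f →
      proj₁ e ≢ proj₁ f × proj₁ e ≢ proj₂ f × proj₂ e ≢ proj₁ f × proj₂ e ≢ proj₂ f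
    flatten ((e₁≢f₁ , e₁≢f₂) , (e₂≢f₁ , e₂≢f₂)) = e₁≢f₁ , e₁≢f₂ , e₂≢f₁ , e₂≢f₂

  reroute : ∀ {S k u u′} (M : RainbowMatchingIn S k) (i : Fin k) →
    let a = proj₁ (edge M i); b = proj₂ (edge M i) in
    T (adj G u a) → T (adj G u′ b) → T (S u) → T (S u′) → u ∉ vertices M → u′ ∉ vertices M → u ≢ u′ →
    col c u a ∉ colors M → col c u′ b ∉ colors M → col c u a ≢ col c u′ b → RainbowMatchingIn S (suc k)
  reroute {S} {k} {u} {u′} M i ua u′b Su Su′ u∉ u′∉ u≢u′ ua∉ u′b∉ ua≢u′b =
    extend M′ (u , a) ua (Su , proj₁ (inside M i)) disjoint-ua rainbow-ua
    where
    a b : Fin n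
    a = proj₁ (edge M i)
    b = proj₂ (edge M i)
    M′ : RainbowMatchingIn S k
    M′ = replace M i (u′ , b) u′b (Su′ , proj₂ (inside M i))
           (λ j j≢i → ∉-vertices M u′∉ j , proj₂ (disjoint M i j (≢-sym j≢i)))
           (λ j _ → ∉-colors M u′b∉ j)
    a≢b : a ≢ b
    a≢b a≡b = irref G a (subst (T ∘ adj G a) (sym a≡b) (isEdge M i))
    disjoint-ua : ∀ j → Disjoint (u , a) (edge M′ j)
    disjoint-ua j with j ≟ᶠ i
    ... | yes refl = (u≢u′ , proj₂ (∉-vertices M u∉ i)) , (≢-sym (proj₁ (∉-vertices M u′∉ i)) , a≢b)
    ... | no j≢i   = ∉-vertices M u∉ j , proj₁ (disjoint M i j (≢-sym j≢i))
    rainbow-ua : ∀ j → col c u a ≢ color (edge M′ j)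
    rainbow-ua j with j ≟ᶠ i
    ... | yes refl = ua≢u′b
    ... | no _     = ∉-colors M ua∉ j

-- Greedy extension

module _ {n : ℕ} {G : Graph n} (c : EdgeColoring G) where

  private
    room : ∀ j L d → 3 * (j + suc L) ≤ suc d → j + (2 * j + suc L) < d
    room j L d 3s≤1+d = m+n≤o⇒m≤o (suc (j + (2 * j + suc L))) (≤-pred (subst (_≤ suc d) (expand j L) 3s≤1+d))
      where
      expand : ∀ j L → 3 * (j + suc L) ≡ suc (suc (j + (2 * j + suc L)) + 2 * L)
      expand = solve-∀

  -- A color of x outside `avoid` (3j + |X| + 1 colors, fewer than its color degree) gives an
  -- edge xw that is new in color and whose end w lies outside M and X.
  greedy : ∀ s {j} (X : List (Fin n)) (M : RainbowMatchingIn c (λ _ → true) j) → j + length X ≡ s →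
    Unique X → All (λ x → 3 * s ≤ suc (colorDegree c x)) X → (∀ {x} → x ∈ X → x ∉ vertices M) →
    RainbowMatchingIn c (λ _ → true) s
  greedy s [] M j+0≡s _ _ _ = subst (RainbowMatchingIn c _) (trans (sym (+-identityʳ _)) j+0≡s) M
  greedy s {j} (x ∷ X) M j+1+|X|≡s (x∉X ∷ X!) (3s≤1+dx ∷ 3s≤1+dX) X∉M =
    greedy s X M′ (trans (sym (+-suc j (length X))) j+1+|X|≡s) X! 3s≤1+dX X∉M′
    where
    avoid : List ℕ
    avoid = colors M ++ map (col c x) (vertices M ++ x ∷ X)
    |avoid| : length avoid ≡ j + (2 * j + suc (length X))
    |avoid| = begin
      length avoid ≡⟨ length-++ (colors M) ⟩
      length (colors M) + length (map (col c x) (vertices M ++ x ∷ X))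
        ≡⟨ cong₂ _+_ (length-colors M) (length-map (col c x) (vertices M ++ x ∷ X)) ⟩
      j + length (vertices M ++ x ∷ X) ≡⟨ cong (j +_) (length-++ (vertices M)) ⟩
      j + (length (vertices M) + suc (length X)) ≡⟨ cong (λ l → j + (l + suc (length X))) (length-vertices M) ⟩
      j + (2 * j + suc (length X)) ∎
      where open ≡-Reasoning
    fresh : ∃ λ w → T (adj G x w) × col c x w ∉ avoid
    fresh = fresh-color c (subst (_< colorDegree c x) (sym |avoid|)
              (room j (length X) (colorDegree c x) (subst (λ s → 3 * s ≤ _) (sym j+1+|X|≡s) 3s≤1+dx)))
    w : Fin n
    w = proj₁ fresh
    xw∉avoid : col c x w ∉ avoid
    xw∉avoid = proj₂ (proj₂ fresh)
    x∉M : x ∉ vertices M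
    x∉M = X∉M (here refl)
    w∉M : w ∉ vertices M
    w∉M w∈M = xw∉avoid (∈-++⁺ʳ (colors M) (∈-map⁺ (col c x) (∈-++⁺ˡ w∈M)))
    w∉x∷X : w ∉ x ∷ X
    w∉x∷X w∈ = xw∉avoid (∈-++⁺ʳ (colors M) (∈-map⁺ (col c x) (∈-++⁺ʳ (vertices M) w∈)))
    xw∉M : col c x w ∉ colors M
    xw∉M = xw∉avoid ∘ ∈-++⁺ˡ
    M′ : RainbowMatchingIn c (λ _ → true) (suc j)
    M′ = extend c M (x , w) (proj₁ (proj₂ fresh)) (tt , tt) (fresh-Disjoint M x∉M w∉M) (∉-colors M xw∉M)
    X∉M′ : ∀ {y} → y ∈ X → y ∉ vertices M′
    X∉M′ y∈X (here refl)          = All.lookup x∉X y∈X refl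
    X∉M′ y∈X (there (here refl))  = w∉x∷X (there y∈X)
    X∉M′ y∈X (there (there y∈M)) = X∉M (there y∈X) y∈M

-- Augmenting a rainbow matching inside S

module Augmentation {n : ℕ} {G : Graph n} (c : EdgeColoring G) {S : Fin n → Bool} {k : ℕ}
                    (M : RainbowMatchingIn c S k) where

  open DecMembership (_≟ᶠ_ {n}) using () renaming (_∈?_ to _∈ᵛ?_)
  open DecMembership _≟ℕ_ using () renaming (_∈?_ to _∈ᶜ?_)

  a b : Fin k → Fin n
  a i = proj₁ (edge M i)
  b i = proj₂ (edge M i)

  Uncovered : Fin n → Set
  Uncovered u = T (S u) × u ∉ vertices M

  FreeEdge : Fin n → Fin n → Set
  FreeEdge u v = T (adj G u v) × col c u v ∉ colors M

  FreeEdge? : ∀ u v → Dec (FreeEdge u v)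
  FreeEdge? u v = T? (adj G u v) ×-dec ¬? (col c u v ∈ᶜ? colors M)

  freeColorsTo : Fin k → Fin n → List ℕ
  freeColorsTo i u =
    union₂ (isYes (FreeEdge? u (a i))) (col c u (a i)) (isYes (FreeEdge? u (b i))) (col c u (b i))

  twoFreeColorsTo : Fin k → Fin n → Bool
  twoFreeColorsTo i u =
    bothDistinct (isYes (FreeEdge? u (a i))) (col c u (a i)) (isYes (FreeEdge? u (b i))) (col c u (b i))

  Extendable : Set
  Extendable = ∃ λ u → ∃ λ w → Uncovered u × Uncovered w × FreeEdge u w

  Reroutable : Set
  Reroutable = ∃ λ i → ∃ λ u → ∃ λ u′ → Uncovered u × Uncovered u′ × u ≢ u′ ×
    FreeEdge u (a i) × FreeEdge u′ (b i) × col c u (a i) ≢ col c u′ (b i)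

  Uncovered? : ∀ u → Dec (Uncovered u)
  Uncovered? u = T? (S u) ×-dec ¬? (u ∈ᵛ? vertices M)

  Extendable? : Dec Extendable
  Extendable? = any? λ u → any? λ w → Uncovered? u ×-dec (Uncovered? w ×-dec FreeEdge? u w)

  Reroutable? : Dec Reroutable
  Reroutable? = any? λ i → any? λ u → any? λ u′ →
    Uncovered? u ×-dec (Uncovered? u′ ×-dec (¬? (u ≟ᶠ u′) ×-dec
      (FreeEdge? u (a i) ×-dec (FreeEdge? u′ (b i) ×-dec ¬? (col c u (a i) ≟ℕ col c u′ (b i))))))

  extendable⇒ : Extendable → RainbowMatchingIn c S (suc k)
  extendable⇒ (u , w , (Su , u∉M) , (Sw , w∉M) , (uw , uw∉M)) =
    extend c M (u , w) uw (Su , Sw) (fresh-Disjoint M u∉M w∉M) (∉-colors M uw∉M)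

  reroutable⇒ : Reroutable → RainbowMatchingIn c S (suc k)
  reroutable⇒ (i , u , u′ , (Su , u∉M) , (Su′ , u′∉M) , u≢u′ , (ua , ua∉M) , (u′b , u′b∉M) , ua≢u′b) =
    reroute c M i ua u′b Su Su′ u∉M u′∉M u≢u′ ua∉M u′b∉M ua≢u′b

  covered : Fin n → Bool
  covered u = isYes (u ∈ᵛ? vertices M)

  insideList coveredList uncoveredList : List (Fin n)
  insideList    = filterᵇ S (allFin n)
  coveredList   = filterᵇ covered insideList
  uncoveredList = filterᵇ (not ∘ covered) insideList

  ∈-uncoveredList⁻ : ∀ {u} → u ∈ uncoveredList → Uncovered u
  ∈-uncoveredList⁻ {u} u∈ =
    let u∈inside , u∉M = ∈-filter⁻ (T? ∘ (not ∘ covered)) {xs = insideList} u∈ in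
    proj₂ (∈-filter⁻ (T? ∘ S) {xs = allFin n} u∈inside) , toWitnessFalse {a? = u ∈ᵛ? vertices M} u∉M

  Unique-insideList : Unique insideList
  Unique-insideList = Uniqueₚ.filter⁺ _ (Uniqueₚ.allFin⁺ n)

  length-coveredList : length coveredList ≤ 2 * k
  length-coveredList = subst (length coveredList ≤_) (length-vertices M)
    (Unique⇒length≤ (Uniqueₚ.filter⁺ _ Unique-insideList)
      (λ {u} u∈ → toWitness {a? = u ∈ᵛ? vertices M} (proj₂ (∈-filter⁻ (T? ∘ covered) {xs = insideList} u∈))))

  colorDegreeInto-uncovered : ¬ Extendable → ∀ {u} → Uncovered u →
    colorDegreeInto c S u ≤ k + ∑[ i ∈ allFin k ] length (freeColorsTo i u)
  colorDegreeInto-uncovered ¬ext {u} u-unc = begin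
    colorDegreeInto c S u          ≤⟨ colorDegreeInto≤length c S incident⊆ ⟩
    length (colors M ++ concatMap (λ i → freeColorsTo i u) (allFin k))
      ≡⟨ length-++ (colors M) ⟩
    length (colors M) + length (concatMap (λ i → freeColorsTo i u) (allFin k))
      ≡⟨ cong₂ _+_ (length-colors M) (length-concatMap (λ i → freeColorsTo i u) (allFin k)) ⟩
    k + ∑[ i ∈ allFin k ] length (freeColorsTo i u) ∎
    where
    open ≤-Reasoning
    -- A free color at u towards an uncovered vertex would extend M, so every other color is
    -- either used by M or free towards an end of some edge of M.
    incident⊆ : ∀ {w} → T (adj G u w) → T (S w) →
      col c u w ∈ colors M ++ concatMap (λ i → freeColorsTo i u) (allFin k)
    incident⊆ {w} uw Sw with col c u w ∈ᶜ? colors M | w ∈ᵛ? vertices M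
    ... | yes uw∈M | _       = ∈-++⁺ˡ uw∈M
    ... | no uw∉M  | no w∉M  = contradiction (u , w , u-unc , (Sw , w∉M) , (uw , uw∉M)) ¬ext
    ... | no uw∉M  | yes w∈M with ∈-vertices⁻ M w∈M
    ...   | i , inj₁ refl = ∈-++⁺ʳ (colors M) (∈-concatMap⁺ (λ i → freeColorsTo i u) (lose (∈-allFin i)
                              (∈-union₂ˡ {isYes (FreeEdge? u (a i))} {isYes (FreeEdge? u (b i))}
                                (fromWitness {a? = FreeEdge? u (a i)} (uw , uw∉M)))))
    ...   | i , inj₂ refl = ∈-++⁺ʳ (colors M) (∈-concatMap⁺ (λ i → freeColorsTo i u) (lose (∈-allFin i)
                              (∈-union₂ʳ {isYes (FreeEdge? u (a i))} {isYes (FreeEdge? u (b i))}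
                                (fromWitness {a? = FreeEdge? u (b i)} (uw , uw∉M)))))

  colors-agree : ¬ Reroutable → ∀ {i u u′} → Uncovered u → Uncovered u′ → u ≢ u′ →
    FreeEdge u (a i) → FreeEdge u′ (b i) → col c u (a i) ≡ col c u′ (b i)
  colors-agree ¬rr {i} {u} {u′} u-unc u′-unc u≢u′ ua u′b with col c u (a i) ≟ℕ col c u′ (b i)
  ... | yes ua≡u′b = ua≡u′b
  ... | no  ua≢u′b = contradiction (i , u , u′ , u-unc , u′-unc , u≢u′ , ua , u′b , ua≢u′b) ¬rr

  -- Three vertices u, v, w with two free colors towards edge i would force
  -- col(u,a) = col(v,b) = col(w,a) = col(u,b).
  length-twoFreeColorsTo : ¬ Reroutable → ∀ i → length (filterᵇ (twoFreeColorsTo i) uncoveredList) ≤ 2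
  length-twoFreeColorsTo ¬rr i =
    Unique-no-three⇒length≤2 (Uniqueₚ.filter⁺ _ (Uniqueₚ.filter⁺ _ Unique-insideList)) no-three
    where
    twoFree : List (Fin n)
    twoFree = filterᵇ (twoFreeColorsTo i) uncoveredList
    Member : Fin n → Set
    Member u = Uncovered u × FreeEdge u (a i) × FreeEdge u (b i) × col c u (a i) ≢ col c u (b i)
    member : ∀ {u} → u ∈ twoFree → Member u
    member {u} u∈ with ∈-filter⁻ (T? ∘ twoFreeColorsTo i) {xs = uncoveredList} u∈
    ... | u∈U , two with bothDistinct⁻ {isYes (FreeEdge? u (a i))} {isYes (FreeEdge? u (b i))} two
    ...   | ua , ub , ua≢ub = ∈-uncoveredList⁻ u∈U , toWitness {a? = FreeEdge? u (a i)} ua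
                            , toWitness {a? = FreeEdge? u (b i)} ub , ua≢ub
    contradict : ∀ {u v w} → Member u → Member v → Member w → u ≢ v → u ≢ w → v ≢ w → ⊥
    contradict (u-unc , ua , ub , ua≢ub) (v-unc , _ , vb , _) (w-unc , wa , _ , _) u≢v u≢w v≢w =
      ua≢ub (trans (colors-agree ¬rr u-unc v-unc u≢v ua vb)
            (trans (sym (colors-agree ¬rr w-unc v-unc (≢-sym v≢w) wa vb))
                   (colors-agree ¬rr w-unc u-unc (≢-sym u≢w) wa ub)))
    no-three : ∀ {u v w} → u ∈ twoFree → v ∈ twoFree → w ∈ twoFree → u ≢ v → u ≢ w → v ≢ w → ⊥
    no-three u∈ v∈ w∈ = contradict (member u∈) (member v∈) (member w∈)

  ∑-freeColorsTo : ¬ Reroutable → ∀ i →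
    ∑[ u ∈ uncoveredList ] length (freeColorsTo i u) ≤ length uncoveredList + 2
  ∑-freeColorsTo ¬rr i = begin
    ∑[ u ∈ uncoveredList ] length (freeColorsTo i u)
      ≤⟨ ∑-mono-≤ uncoveredList (λ {u} _ → length-union₂ (isYes (FreeEdge? u (a i))) (col c u (a i))
                                                          (isYes (FreeEdge? u (b i))) (col c u (b i))) ⟩
    ∑[ u ∈ uncoveredList ] (1 + 𝟙 (twoFreeColorsTo i u))
      ≡⟨ ∑-distrib-+ (λ _ → 1) (𝟙 ∘ twoFreeColorsTo i) uncoveredList ⟩
    ∑[ _ ∈ uncoveredList ] 1 + ∑[ u ∈ uncoveredList ] 𝟙 (twoFreeColorsTo i u)
      ≡⟨ cong₂ _+_ (∑-1 uncoveredList) (∑-𝟙 (twoFreeColorsTo i) uncoveredList) ⟩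
    length uncoveredList + length (filterᵇ (twoFreeColorsTo i) uncoveredList)
      ≤⟨ +-monoʳ-≤ (length uncoveredList) (length-twoFreeColorsTo ¬rr i) ⟩
    length uncoveredList + 2 ∎
    where open ≤-Reasoning

  extend-or-bound : RainbowMatchingIn c S (suc k) ⊎
    ∑[ u ∈ uncoveredList ] colorDegreeInto c S u ≤ k * length uncoveredList + (length uncoveredList + 2) * k
  extend-or-bound with Extendable? | Reroutable?
  ... | yes ext | _      = inj₁ (extendable⇒ ext)
  ... | no _    | yes rr = inj₁ (reroutable⇒ rr)
  ... | no ¬ext | no ¬rr = inj₂ (begin
    ∑[ u ∈ uncoveredList ] colorDegreeInto c S u
      ≤⟨ ∑-mono-≤ uncoveredList (colorDegreeInto-uncovered ¬ext ∘ ∈-uncoveredList⁻) ⟩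
    ∑[ u ∈ uncoveredList ] (k + ∑[ i ∈ allFin k ] length (freeColorsTo i u))
      ≡⟨ ∑-distrib-+ (λ _ → k) _ uncoveredList ⟩
    ∑[ _ ∈ uncoveredList ] k + ∑[ u ∈ uncoveredList ] ∑[ i ∈ allFin k ] length (freeColorsTo i u)
      ≡⟨ cong₂ _+_ (∑-const k uncoveredList) (∑-comm uncoveredList (allFin k) _) ⟩
    k * length uncoveredList + ∑[ i ∈ allFin k ] ∑[ u ∈ uncoveredList ] length (freeColorsTo i u)
      ≤⟨ +-monoʳ-≤ (k * length uncoveredList) (∑-mono-≤ (allFin k) (λ {i} _ → ∑-freeColorsTo ¬rr i)) ⟩
    k * length uncoveredList + ∑[ _ ∈ allFin k ] (length uncoveredList + 2)
      ≡⟨ cong (k * length uncoveredList +_)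
              (trans (∑-const _ (allFin k)) (cong ((length uncoveredList + 2) *_) (length-tabulate _))) ⟩
    k * length uncoveredList + (length uncoveredList + 2) * k ∎)
    where open ≤-Reasoning

-- Counting

module _ (j r s : ℕ) where

  colorSum-lower : ∀ N D → 2 * suc (j + r + s) * (N + r) ≤ D + r * N + (N + r) * r → 2 * suc j * N ≤ D
  colorSum-lower N D total = +-cancelʳ-≤ (r * N + (N + r) * r) (2 * suc j * N) D (begin
    2 * suc j * N + (r * N + (N + r) * r)
      ≤⟨ m≤m+n _ (2 * s * N + 2 * suc (j + s) * r + r * r) ⟩
    2 * suc j * N + (r * N + (N + r) * r) + (2 * s * N + 2 * suc (j + s) * r + r * r)
      ≡⟨ expand j r s N ⟩
    2 * suc (j + r + s) * (N + r) ≤⟨ total ⟩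
    D + r * N + (N + r) * r ≡⟨ +-assoc D (r * N) _ ⟩
    D + (r * N + (N + r) * r) ∎)
    where
    open ≤-Reasoning
    expand : ∀ j r s N → 2 * suc j * N + (r * N + (N + r) * r) + (2 * s * N + 2 * suc (j + s) * r + r * r)
                         ≡ 2 * suc (j + r + s) * (N + r)
    expand = solve-∀

  uncovered-bound : ∀ c₁ c₂ D → 2 * suc j * (c₁ + c₂) ≤ D →
    D ≤ (4 * (j + r + s) + 1) * c₁ + (j * c₂ + (c₂ + 2) * j) → c₂ ≤ (j + 2 * r + 2 * s) * c₁ + j
  uncovered-bound c₁ c₂ D lower upper = *-cancelˡ-≤ 2 (+-cancelʳ-≤ P (2 * c₂) _ (begin
    2 * c₂ + P                 ≡⟨ split-lower j c₁ c₂ ⟩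
    2 * suc j * (c₁ + c₂)      ≤⟨ lower ⟩
    D                          ≤⟨ upper ⟩
    (4 * (j + r + s) + 1) * c₁ + (j * c₂ + (c₂ + 2) * j) ≤⟨ m≤m+n _ c₁ ⟩
    (4 * (j + r + s) + 1) * c₁ + (j * c₂ + (c₂ + 2) * j) + c₁ ≡⟨ split-upper j r s c₁ c₂ ⟩
    2 * ((j + 2 * r + 2 * s) * c₁ + j) + P ∎))
    where
    open ≤-Reasoning
    P : ℕ
    P = 2 * suc j * c₁ + 2 * j * c₂
    split-lower : ∀ j c₁ c₂ → 2 * c₂ + (2 * suc j * c₁ + 2 * j * c₂) ≡ 2 * suc j * (c₁ + c₂)
    split-lower = solve-∀
    split-upper : ∀ j r s c₁ c₂ → (4 * (j + r + s) + 1) * c₁ + (j * c₂ + (c₂ + 2) * j) + c₁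
                  ≡ 2 * ((j + 2 * r + 2 * s) * c₁ + j) + (2 * suc j * c₁ + 2 * j * c₂)
    split-upper = solve-∀

  vertex-bound : ∀ c₁ c₂ → c₁ ≤ 2 * j → c₂ ≤ (j + 2 * r + 2 * s) * c₁ + j →
    c₁ + c₂ + r < 3 * (suc (j + r + s) * suc (j + r + s)) + 4 * suc (j + r + s)
  vertex-bound c₁ c₂ c₁≤2j c₂≤ = begin-strict
    c₁ + c₂ + r
      ≤⟨ +-monoˡ-≤ r (+-mono-≤ c₁≤2j (≤-trans c₂≤ (+-monoˡ-≤ j (*-monoʳ-≤ (j + 2 * r + 2 * s) c₁≤2j)))) ⟩
    R <⟨ s≤s (m≤m+n R Z) ⟩
    suc (R + Z) ≡⟨ expand j r s ⟩
    3 * (suc (j + r + s) * suc (j + r + s)) + 4 * suc (j + r + s) ∎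
    where
    open ≤-Reasoning
    R Z : ℕ
    R = 2 * j + ((j + 2 * r + 2 * s) * (2 * j) + j) + r
    Z = j * j + 3 * (r * r) + 3 * (s * s) + 2 * j * r + 2 * j * s + 6 * r * s + 7 * j + 9 * r + 10 * s + 6
    expand : ∀ j r s →
      suc (2 * j + ((j + 2 * r + 2 * s) * (2 * j) + j) + r +
           (j * j + 3 * (r * r) + 3 * (s * s) + 2 * j * r + 2 * j * s + 6 * r * s + 7 * j + 9 * r + 10 * s + 6))
      ≡ 3 * (suc (j + r + s) * suc (j + r + s)) + 4 * suc (j + r + s)
    expand = solve-∀

m<o∸n⇒m+n<o : ∀ {m n o} → m < o ∸ n → m + n < o
m<o∸n⇒m+n<o {m} {n} {o} m<o∸n = m≤o∸n⇒m+n≤o (suc m) n≤o m<o∸n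
  where
  n≤o : n ≤ o
  n≤o = <⇒≤ (m∸n≢0⇒n<m λ o∸n≡0 → contradiction (subst (m <_) o∸n≡0 m<o∸n) λ ())

-- r rich vertices, c₁ covered and c₂ uncovered poor vertices for a matching of size j, and D the
-- sum over poor vertices of their color degree into the poor set.
too-few-vertices : ∀ m₀ j r c₁ c₂ D → suc j + r ≤ suc m₀ → c₁ ≤ 2 * j →
  D ≤ (4 * m₀ + 1) * c₁ + (j * c₂ + (c₂ + 2) * j) →
  2 * suc m₀ * (c₁ + c₂ + r) ≤ D + r * (c₁ + c₂) + (c₁ + c₂ + r) * r →
  c₁ + c₂ + r < 3 * (suc m₀ * suc m₀) + 4 * suc m₀
too-few-vertices m₀ j r c₁ c₂ D j+r<m c₁≤2j upper total with m≤n⇒∃[o]m+o≡n (≤-pred j+r<m)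
... | s , refl = vertex-bound j r s c₁ c₂ c₁≤2j
  (uncovered-bound j r s c₁ c₂ D (colorSum-lower j r s (c₁ + c₂) D total) upper)

module _ {n : ℕ} {G : Graph n} (c : EdgeColoring G) (m₀ : ℕ) where

  poor : Fin n → Bool
  poor v = isYes (colorDegree c v ≤? 4 * m₀ + 1)

  poorList richList : List (Fin n)
  poorList = filterᵇ poor (allFin n)
  richList = filterᵇ (not ∘ poor) (allFin n)

  colorDegree-poor : ∀ {v} → v ∈ poorList → colorDegree c v ≤ 4 * m₀ + 1
  colorDegree-poor {v} v∈ =
    toWitness {a? = colorDegree c v ≤? 4 * m₀ + 1} (proj₂ (∈-filter⁻ (T? ∘ poor) {xs = allFin n} v∈))

  rich⇒¬poor : ∀ {v} → v ∈ richList → ¬ T (poor v)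
  rich⇒¬poor {v} v∈ = T-not⇒¬T (proj₂ (∈-filter⁻ (T? ∘ (not ∘ poor)) {xs = allFin n} v∈))

  colorDegree-rich : ∀ {v} → v ∈ richList → 4 * m₀ + 1 < colorDegree c v
  colorDegree-rich {v} v∈ = ≰⇒> (toWitnessFalse {a? = colorDegree c v ≤? 4 * m₀ + 1}
    (proj₂ (∈-filter⁻ (T? ∘ (not ∘ poor)) {xs = allFin n} v∈)))

  totalColorDegree≤ : totalColorDegree c ≤
    ∑[ v ∈ poorList ] colorDegreeInto c poor v + length richList * length poorList + n * length richList
  totalColorDegree≤ = begin
    totalColorDegree c ≡⟨ ∑-partition poor (allFin n) (colorDegree c) ⟩
    ∑ poorList (colorDegree c) + ∑ richList (colorDegree c)
      ≤⟨ +-mono-≤ (∑-mono-≤ poorList (λ {v} _ → colorDegree≤colorDegreeInto+ c poor v))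
                  (∑-mono-≤ richList (λ {v} _ → colorDegree≤n c v)) ⟩
    ∑[ v ∈ poorList ] (colorDegreeInto c poor v + length richList) + ∑[ _ ∈ richList ] n
      ≡⟨ cong₂ _+_ (trans (∑-distrib-+ (colorDegreeInto c poor) _ poorList)
                          (cong (∑ poorList (colorDegreeInto c poor) +_) (∑-const _ poorList)))
                   (∑-const n richList) ⟩
    ∑[ v ∈ poorList ] colorDegreeInto c poor v + length richList * length poorList + n * length richList ∎
    where open ≤-Reasoning

  module _ {j} (M : RainbowMatchingIn c poor j) where
    open Augmentation c M

    ∑-colorDegreeInto-poor : ∑[ v ∈ poorList ] colorDegreeInto c poor v ≤
      (4 * m₀ + 1) * length coveredList + ∑[ u ∈ uncoveredList ] colorDegreeInto c poor u
    ∑-colorDegreeInto-poor = begin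
      ∑ poorList (colorDegreeInto c poor) ≡⟨ ∑-partition covered poorList _ ⟩
      ∑ coveredList (colorDegreeInto c poor) + ∑ uncoveredList (colorDegreeInto c poor)
        ≤⟨ +-monoˡ-≤ _ (∑-mono-≤ coveredList λ {v} v∈ →
             ≤-trans (colorDegreeInto≤colorDegree c poor v)
                     (colorDegree-poor (proj₁ (∈-filter⁻ (T? ∘ covered) {xs = poorList} v∈)))) ⟩
      ∑[ _ ∈ coveredList ] (4 * m₀ + 1) + ∑ uncoveredList (colorDegreeInto c poor)
        ≡⟨ cong (_+ ∑ uncoveredList (colorDegreeInto c poor)) (∑-const _ coveredList) ⟩
      (4 * m₀ + 1) * length coveredList + ∑ uncoveredList (colorDegreeInto c poor) ∎
      where open ≤-Reasoning

  module _ (n-large : 3 * (suc m₀ * suc m₀) + 4 * suc m₀ ≤ n)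
           (T-large : 2 * suc m₀ * n ≤ totalColorDegree c) where

    no-bound : ∀ {j} (M : RainbowMatchingIn c poor j) → suc j + length richList ≤ suc m₀ →
      let open Augmentation c M in
      ¬ (∑[ u ∈ uncoveredList ] colorDegreeInto c poor u ≤
         j * length uncoveredList + (length uncoveredList + 2) * j)
    no-bound {j} M j+r<m bound = <⇒≱ (subst (_< _) (sym n≡) too-few) n-large
      where
      open Augmentation c M
      r c₁ c₂ : ℕ
      r = length richList
      c₁ = length coveredList
      c₂ = length uncoveredList
      p≡ : length poorList ≡ c₁ + c₂
      p≡ = length-partition covered poorList
      n≡ : n ≡ c₁ + c₂ + r
      n≡ = trans (trans (sym (length-tabulate _)) (length-partition poor (allFin n))) (cong (_+ r) p≡)
      too-few : c₁ + c₂ + r < 3 * (suc m₀ * suc m₀) + 4 * suc m₀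
      too-few = too-few-vertices m₀ j r c₁ c₂ _ j+r<m length-coveredList
        (≤-trans (∑-colorDegreeInto-poor M) (+-monoʳ-≤ _ bound))
        (subst₂ (λ N P → 2 * suc m₀ * N ≤ ∑ poorList (colorDegreeInto c poor) + r * P + N * r) n≡ p≡
          (≤-trans T-large totalColorDegree≤))

    grow : ∀ j → j ≤ suc m₀ ∸ length richList → RainbowMatchingIn c poor j
    grow zero    _       = empty c
    grow (suc j) j<m-r with grow j (<⇒≤ j<m-r)
    ... | M with Augmentation.extend-or-bound c M
    ...   | inj₁ M′    = M′
    ...   | inj₂ bound = contradiction bound (no-bound M (m<o∸n⇒m+n<o j<m-r))

    rainbowMatching : RainbowMatching G c (suc m₀)
    rainbowMatching = toRainbowMatching c
      (greedy c (suc m₀) X (weaken c M) size (Uniqueₚ.take⁺ _ (Uniqueₚ.filter⁺ _ (Uniqueₚ.allFin⁺ n)))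
              (Allₚ.take⁺ _ (All.tabulate rich-room)) (All.lookup (Allₚ.take⁺ _ (All.tabulate rich∉M))))
      where
      r : ℕ
      r = length richList
      M : RainbowMatchingIn c poor (suc m₀ ∸ r)
      M = grow (suc m₀ ∸ r) ≤-refl
      X : List (Fin n)
      X = take (suc m₀) richList
      size : suc m₀ ∸ r + length X ≡ suc m₀
      size = begin
        suc m₀ ∸ r + length X
          ≡⟨ cong (suc m₀ ∸ r +_) (trans (length-take (suc m₀) richList) (⊓-comm (suc m₀) r)) ⟩
        suc m₀ ∸ r + r ⊓ suc m₀   ≡⟨ +-comm (suc m₀ ∸ r) _ ⟩
        r ⊓ suc m₀ + (suc m₀ ∸ r) ≡⟨ m⊓n+n∸m≡n r (suc m₀) ⟩
        suc m₀ ∎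
        where open ≡-Reasoning
      rich-room : ∀ {x} → x ∈ richList → 3 * suc m₀ ≤ suc (colorDegree c x)
      rich-room x∈ =
        ≤-trans (subst (3 * suc m₀ ≤_) (expand m₀) (m≤m+n (3 * suc m₀) m₀)) (s≤s (colorDegree-rich x∈))
        where
        expand : ∀ m₀ → 3 * suc m₀ + m₀ ≡ suc (suc (4 * m₀ + 1))
        expand = solve-∀
      rich∉M : ∀ {x} → x ∈ richList → x ∉ vertices (weaken c M)
      rich∉M x∈ = outside⇒∉vertices M (rich⇒¬poor x∈)

theorem4 : (m n : ℕ) → (G : Graph n) → (c : EdgeColoring G) →
    n ≥ 3 * (m * m) + 4 * m →
    totalColorDegree c ≥ 2 * m * n →
    RainbowMatching G c m
theorem4 zero     n G c _       _       = toRainbowMatching c (empty c {S = λ _ → true})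
theorem4 (suc m₀) n G c n-large T-large = rainbowMatching c m₀ n-large T-large
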